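{- Let $A$ and $B$ be two $n\times n$ matrices over a field. Then $A$ and $B$ are principal minor equivalent if and only if for every nonempty $S\subseteq[n]$, the sum of the weights of the directed Hamiltonian cycles of $G_A[S]$ equals the sum of the weights of the directed Hamiltonian cycles of $G_B[S]$.
   Context: Principal minor equivalent: $\det(A[S])=\det(B[S])$ for all $S\subseteq[n]$, where $A[S]$ is the principal submatrix on $S$. $G_A$ is the directed graph on $[n]$ (loops allowed) with an edge $(i,j)$ iff $A[i,j]\ne0$; $G_A[S]$ is its induced subgraph on $S$. A directed Hamiltonian cycle of $G_A[S]$ is a directed cycle of $G_A$ passing through every vertex of $S$ exactly once (for $|S|=1$, the loop at that vertex), and its weight is $w_A(C)=\prod_{(i,j)\in C}A[i,j]$. -}

module Defs where

open import Level using (Level; _⊔_) renaming (suc to lsuc)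
open import Algebra.Bundles using (CommutativeRing)
open import Data.Nat using (ℕ; zero; suc)
open import Data.Fin using (Fin; zero; suc; punchIn)
open import Data.Fin.Subset using (Subset; Nonempty)
open import Data.List using (List; []; _∷_; map; length; lookup; concatMap)
open import Data.Vec using ([]; _∷_)
open import Data.Bool using (true; false)
open import Data.Product using (∃)
open import Relation.Nullary using (¬_)

record Field (c ℓ : Level) : Set (lsuc (c ⊔ ℓ)) where
  field
    commutativeRing : CommutativeRing c ℓ
  open CommutativeRing commutativeRing public
  field
    0≉1     : ¬ (0# ≈ 1#)
    inverse : ∀ x → ¬ (x ≈ 0#) → ∃ λ y → (x * y) ≈ 1#

insertions : {a : Level} {X : Set a} → X → List X → List (List X)
insertions x []       = (x ∷ []) ∷ []
insertions x (y ∷ ys) = (x ∷ y ∷ ys) ∷ map (y ∷_) (insertions x ys)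

perms : {a : Level} {X : Set a} → List X → List (List X)
perms []       = [] ∷ []
perms (x ∷ xs) = concatMap (insertions x) (perms xs)

module _ {c ℓ : Level} (F : Field c ℓ) where
  open Field F using (Carrier; _≈_; _+_; _*_; -_; 0#; 1#)

  Matrix : ℕ → Set c
  Matrix n = Fin n → Fin n → Carrier

  sumFin : ∀ {k} → (Fin k → Carrier) → Carrier
  sumFin {zero}  f = 0#
  sumFin {suc k} f = f zero + sumFin (λ i → f (suc i))

  sgn : ∀ {k} → Fin k → Carrier
  sgn zero    = 1#
  sgn (suc j) = - sgn j

  det : ∀ {k} → Matrix k → Carrier
  det {zero}  M = 1#
  det {suc k} M =
    sumFin (λ j → (sgn j * M zero j) * det (λ a b → M (suc a) (punchIn j b)))

  members : ∀ {n} → Subset n → List (Fin n)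
  members []          = []
  members (true ∷ p)  = zero ∷ map suc (members p)
  members (false ∷ p) = map suc (members p)

  principalSubmatrix : ∀ {n} → Matrix n → (S : Subset n) → Matrix (length (members S))
  principalSubmatrix A S i j = A (lookup (members S) i) (lookup (members S) j)

  PrincipalMinorEquivalent : ∀ {n} → Matrix n → Matrix n → Set ℓ
  PrincipalMinorEquivalent A B =
    ∀ S → det (principalSubmatrix A S) ≈ det (principalSubmatrix B S)

  sumList : List Carrier → Carrier
  sumList []       = 0#
  sumList (x ∷ xs) = x + sumList xs

  -- directed Hamiltonian cycles on the vertex set S: a cycle through every
  -- vertex of S exactly once is determined by the cyclic order starting at the
  -- least vertex s₀ of S, i.e.  s₀ → p₁ → … → p_{m-1} → s₀  for an ordering
  -- p of S ∖ {s₀}  (for |S| = 1 this is the loop at s₀).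
  walkWeight : ∀ {n} → Matrix n → Fin n → Fin n → List (Fin n) → Carrier
  walkWeight A s u []       = A u s
  walkWeight A s u (v ∷ vs) = A u v * walkWeight A s v vs

  cycleWeight : ∀ {n} → Matrix n → Fin n → List (Fin n) → Carrier
  cycleWeight A s p = walkWeight A s s p

  -- Σ of w_A(C) over directed Hamiltonian cycles C on S.  Cycles using a
  -- non-edge of G_A (some A[i,j] = 0) contribute weight 0.
  hamiltonianCycleSum : ∀ {n} → Matrix n → Subset n → Carrier
  hamiltonianCycleSum A S with members S
  ... | []      = 0#
  ... | s ∷ rest = sumList (map (cycleWeight A s) (perms rest))

module Submission where

-- Expanding a principal minor along the cycle through its first vertex gives
--   det A[s ∷ L] = Σ_{K ⊔ R = L} (-1)^|K| · h_A(s ∷ K) · det A[R],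
-- where h_A(T) is the sum of the weights of the Hamiltonian cycles on T.  It comes from the
-- Laplace expansion: det[u ∷ L ; s ∷ L] is a signed sum over paths u → σ₁ → … → σₖ → s
-- through distinct vertices of L, times the principal minor on the unused vertices, and for
-- u = s these paths close up to the cycles through s.  In the identity for S = s ∷ L, h_A(S)
-- occurs only in the term K = L (where det A[∅] = 1); every other term involves proper subsets
-- of S, so each family of invariants determines the other by induction on |S|.

open import Defs
open import Data.Nat using (ℕ; zero; suc; _<_; s≤s)
open import Data.Nat.Properties using (≤-reflexive)
open import Data.Nat.Induction using (<-wellFounded)
open import Data.Fin using (Fin; zero; suc; punchIn)
open import Data.Fin.Subset using (Subset; Nonempty) renaming (_∈_ to _∈ₛ_)
open import Data.List using (List; []; _∷_; map; length; lookup; concatMap; tabulate; _++_; [_])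
open import Data.List.Properties using (map-∘; ++-assoc; tabulate-lookup)
open import Data.List.Membership.Propositional using (_∈_; find)
open import Data.List.Membership.Propositional.Properties using (∈-map⁻; ∈-concatMap⁻)
open import Data.List.Relation.Unary.Any using (here; there)
open import Data.List.Relation.Binary.Sublist.Propositional using (_⊆_; []; _∷_; _∷ʳ_; ⊆-refl; ⊆-trans)
open import Data.List.Relation.Binary.Sublist.Propositional.Properties using (length-mono-≤; ∷ˡ⁻)
open import Data.Bool using (true; false)
open import Data.Vec.Base using ([]; _∷_; here; there)
open import Data.Product using (_×_; _,_; ∃)
open import Function.Bundles using (_⇔_; mk⇔)
open import Relation.Binary.PropositionalEquality using (_≡_)
import Relation.Binary.PropositionalEquality as ≡
open import Relation.Binary.Construct.On using () renaming (wellFounded to wellFounded-on)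
import Induction.WellFounded as WF
import Algebra.Properties.Ring as RingProperties
import Algebra.Properties.CommutativeSemigroup as CommutativeSemigroupProperties

lengthInduction : ∀ {a p} {X : Set a} (P : List X → Set p) →
                  (∀ xs → (∀ ys → length ys < length xs → P ys) → P xs) → ∀ xs → P xs
lengthInduction {p = p} P step =
  WF.All.wfRec (wellFounded-on length <-wellFounded) p P (λ xs rec → step xs (λ ys → rec))

module CycleExpansion {c ℓ} (F : Field c ℓ) where
  open Field F hiding (zero)
  open import Relation.Binary.Reasoning.Setoid setoid
  open RingProperties ring using (-0#≈0#; -‿involutive; -‿+-comm; -‿distribˡ-*; -‿distribʳ-*; +-cancelʳ)
  open CommutativeSemigroupProperties +-commutativeSemigroup using ()
    renaming (x∙yz≈y∙xz to x+yz≈y+xz; interchange to +-interchange)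
  open CommutativeSemigroupProperties *-commutativeSemigroup using () renaming (x∙yz≈y∙xz to x*yz≈y*xz)

  signℕ : ℕ → Carrier
  signℕ zero    = 1#
  signℕ (suc k) = - signℕ k

  sign : ∀ {X : Set} → List X → Carrier
  sign xs = signℕ (length xs)

  signℕ*signℕ≈1 : ∀ k → signℕ k * signℕ k ≈ 1#
  signℕ*signℕ≈1 zero    = *-identityˡ 1#
  signℕ*signℕ≈1 (suc k) = begin
    - signℕ k * - signℕ k     ≈⟨ -‿distribˡ-* _ _ ⟨
    - (signℕ k * - signℕ k)   ≈⟨ -‿cong (-‿distribʳ-* _ _) ⟨
    - - (signℕ k * signℕ k)   ≈⟨ -‿involutive _ ⟩
    signℕ k * signℕ k         ≈⟨ signℕ*signℕ≈1 k ⟩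
    1#                        ∎

  sign-cancel : ∀ k {x y} → signℕ k * x ≈ signℕ k * y → x ≈ y
  sign-cancel k {x} {y} eq = begin
    x                           ≈⟨ *-identityˡ x ⟨
    1# * x                      ≈⟨ *-cong (signℕ*signℕ≈1 k) refl ⟨
    (signℕ k * signℕ k) * x     ≈⟨ *-assoc _ _ _ ⟩
    signℕ k * (signℕ k * x)     ≈⟨ *-cong refl eq ⟩
    signℕ k * (signℕ k * y)     ≈⟨ *-assoc _ _ _ ⟨
    (signℕ k * signℕ k) * y     ≈⟨ *-cong (signℕ*signℕ≈1 k) refl ⟩
    1# * y                      ≈⟨ *-identityˡ y ⟩
    y                           ∎

  sign-∷ʳ : ∀ {X : Set} (P : List X) x → sign (P ++ [ x ]) ≈ - sign P
  sign-∷ʳ []      x = refl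
  sign-∷ʳ (p ∷ P) x = -‿cong (sign-∷ʳ P x)

  module _ {X : Set} where

    sumOver : List X → (X → Carrier) → Carrier
    sumOver xs f = sumList F (map f xs)

    sumOver-cong : ∀ xs {f g : X → Carrier} → (∀ {x} → x ∈ xs → f x ≈ g x) → sumOver xs f ≈ sumOver xs g
    sumOver-cong []       eq = refl
    sumOver-cong (x ∷ xs) eq = +-cong (eq (here ≡.refl)) (sumOver-cong xs (λ x∈ → eq (there x∈)))

    sumOver-+ : ∀ xs (f g : X → Carrier) → sumOver xs (λ x → f x + g x) ≈ sumOver xs f + sumOver xs g
    sumOver-+ []       f g = sym (+-identityˡ 0#)
    sumOver-+ (x ∷ xs) f g = trans (+-cong refl (sumOver-+ xs f g)) (+-interchange _ _ _ _)

    sumOver-*ˡ : ∀ xs a (f : X → Carrier) → sumOver xs (λ x → a * f x) ≈ a * sumOver xs f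
    sumOver-*ˡ []       a f = sym (zeroʳ a)
    sumOver-*ˡ (x ∷ xs) a f = trans (+-cong refl (sumOver-*ˡ xs a f)) (sym (distribˡ a _ _))

    sumOver-*ʳ : ∀ xs a (f : X → Carrier) → sumOver xs (λ x → f x * a) ≈ sumOver xs f * a
    sumOver-*ʳ []       a f = sym (zeroˡ a)
    sumOver-*ʳ (x ∷ xs) a f = trans (+-cong refl (sumOver-*ʳ xs a f)) (sym (distribʳ a _ _))

    sumOver-++ : ∀ xs ys (f : X → Carrier) → sumOver (xs ++ ys) f ≈ sumOver xs f + sumOver ys f
    sumOver-++ []       ys f = sym (+-identityˡ _)
    sumOver-++ (x ∷ xs) ys f = trans (+-cong refl (sumOver-++ xs ys f)) (sym (+-assoc _ _ _))

  sumOver-concatMap : ∀ {X Y : Set} (g : X → List Y) xs (f : Y → Carrier) →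
                      sumOver (concatMap g xs) f ≈ sumOver xs (λ x → sumOver (g x) f)
  sumOver-concatMap g []       f = refl
  sumOver-concatMap g (x ∷ xs) f = trans (sumOver-++ (g x) _ f) (+-cong refl (sumOver-concatMap g xs f))

  sumOver-map : ∀ {X Y : Set} (g : X → Y) xs (f : Y → Carrier) → sumOver (map g xs) f ≡ sumOver xs (λ x → f (g x))
  sumOver-map g xs f = ≡.cong (sumList F) (≡.sym (map-∘ xs))

  module _ {X : Set} where

    ∈-insertions-length : ∀ {x : X} {τ} σ → τ ∈ insertions x σ → length τ ≡ suc (length σ)
    ∈-insertions-length []      (here ≡.refl) = ≡.refl
    ∈-insertions-length (y ∷ σ) (here ≡.refl) = ≡.refl
    ∈-insertions-length (y ∷ σ) (there τ∈) with ∈-map⁻ (y ∷_) τ∈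
    ... | τ′ , τ′∈ , ≡.refl = ≡.cong suc (∈-insertions-length σ τ′∈)

    ∈-perms-length : ∀ {σ : List X} K → σ ∈ perms K → length σ ≡ length K
    ∈-perms-length []      (here ≡.refl) = ≡.refl
    ∈-perms-length (x ∷ K) σ∈ with find (∈-concatMap⁻ (insertions x) {xs = perms K} σ∈)
    ... | ρ , ρ∈ , σ∈′ = ≡.trans (∈-insertions-length ρ σ∈′) (≡.cong suc (∈-perms-length K ρ∈))

    sumOver-insertions-∷ : ∀ x y σ (f : List X → Carrier) →
                           sumOver (insertions x (y ∷ σ)) f ≈ f (x ∷ y ∷ σ) + sumOver (insertions x σ) (λ τ → f (y ∷ τ))
    sumOver-insertions-∷ x y σ f = +-cong refl (reflexive (sumOver-map (y ∷_) (insertions x σ) f))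

    sumOver-perms-∷ : ∀ x K (f : List X → Carrier) →
                      sumOver (perms (x ∷ K)) f ≈ sumOver (perms K) (λ σ → sumOver (insertions x σ) f)
    sumOver-perms-∷ x K f = sumOver-concatMap (insertions x) (perms K) f

  module _ {X : Set} where

    sumPicks : List X → (X → List X → Carrier) → Carrier
    sumPicks []       G = 0#
    sumPicks (x ∷ xs) G = G x xs + sumPicks xs (λ y r → G y (x ∷ r))

    altSumPicks : List X → (X → List X → Carrier) → Carrier
    altSumPicks []       G = 0#
    altSumPicks (x ∷ xs) G = G x xs + - altSumPicks xs (λ y r → G y (x ∷ r))

    sumPicks-cong : ∀ L {G H : X → List X → Carrier} →
                    (∀ y r → suc (length r) ≡ length L → G y r ≈ H y r) → sumPicks L G ≈ sumPicks L H
    sumPicks-cong []       eq = refl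
    sumPicks-cong (x ∷ xs) eq =
      +-cong (eq x xs ≡.refl) (sumPicks-cong xs (λ y r e → eq y (x ∷ r) (≡.cong suc e)))

    sumPicks-+ : ∀ L (G H : X → List X → Carrier) →
                 sumPicks L (λ y r → G y r + H y r) ≈ sumPicks L G + sumPicks L H
    sumPicks-+ []       G H = sym (+-identityˡ 0#)
    sumPicks-+ (x ∷ xs) G H = trans (+-cong refl (sumPicks-+ xs _ _)) (+-interchange _ _ _ _)

    sumPicks-neg : ∀ L (G : X → List X → Carrier) → sumPicks L (λ y r → - G y r) ≈ - sumPicks L G
    sumPicks-neg []       G = sym -0#≈0#
    sumPicks-neg (x ∷ xs) G = trans (+-cong refl (sumPicks-neg xs _)) (-‿+-comm _ _)

    altSumPicks-cong : ∀ L {G H : X → List X → Carrier} →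
                       (∀ y r → G y r ≈ H y r) → altSumPicks L G ≈ altSumPicks L H
    altSumPicks-cong []       eq = refl
    altSumPicks-cong (x ∷ xs) eq = +-cong (eq x xs) (-‿cong (altSumPicks-cong xs (λ y r → eq y (x ∷ r))))

    altSumPicks-+ : ∀ L (G H : X → List X → Carrier) →
                    altSumPicks L (λ y r → G y r + H y r) ≈ altSumPicks L G + altSumPicks L H
    altSumPicks-+ []       G H = sym (+-identityˡ 0#)
    altSumPicks-+ (x ∷ xs) G H =
      trans (+-cong refl (trans (-‿cong (altSumPicks-+ xs _ _)) (sym (-‿+-comm _ _)))) (+-interchange _ _ _ _)

    altSumPicks-* : ∀ L a (G : X → List X → Carrier) → altSumPicks L (λ y r → a * G y r) ≈ a * altSumPicks L G
    altSumPicks-* []       a G = sym (zeroʳ a)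
    altSumPicks-* (x ∷ xs) a G =
      trans (+-cong refl (trans (-‿cong (altSumPicks-* xs a _)) (-‿distribʳ-* _ _))) (sym (distribˡ a _ _))

    altSumPicks-neg : ∀ L (G : X → List X → Carrier) → altSumPicks L (λ y r → - G y r) ≈ - altSumPicks L G
    altSumPicks-neg []       G = sym -0#≈0#
    altSumPicks-neg (x ∷ xs) G = trans (+-cong refl (-‿cong (altSumPicks-neg xs _))) (-‿+-comm _ _)

    sumSplits : List X → (List X → List X → Carrier) → Carrier
    sumSplits []       Φ = Φ [] []
    sumSplits (x ∷ xs) Φ = sumSplits xs (λ K R → Φ (x ∷ K) R) + sumSplits xs (λ K R → Φ K (x ∷ R))

    sumSplits-cong : ∀ L {Φ Ψ : List X → List X → Carrier} →
                     (∀ K R → K ⊆ L → R ⊆ L → Φ K R ≈ Ψ K R) → sumSplits L Φ ≈ sumSplits L Ψ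
    sumSplits-cong []       eq = eq [] [] [] []
    sumSplits-cong (x ∷ xs) eq =
      +-cong (sumSplits-cong xs (λ K R K⊆ R⊆ → eq (x ∷ K) R (≡.refl ∷ K⊆) (x ∷ʳ R⊆)))
             (sumSplits-cong xs (λ K R K⊆ R⊆ → eq K (x ∷ R) (x ∷ʳ K⊆) (≡.refl ∷ R⊆)))

    sumSplits-+ : ∀ L (Φ Ψ : List X → List X → Carrier) →
                  sumSplits L (λ K R → Φ K R + Ψ K R) ≈ sumSplits L Φ + sumSplits L Ψ
    sumSplits-+ []       Φ Ψ = refl
    sumSplits-+ (x ∷ xs) Φ Ψ = trans (+-cong (sumSplits-+ xs _ _) (sumSplits-+ xs _ _)) (+-interchange _ _ _ _)

    sumSplits-*ˡ : ∀ L a (Φ : List X → List X → Carrier) → sumSplits L (λ K R → a * Φ K R) ≈ a * sumSplits L Φ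
    sumSplits-*ˡ []       a Φ = refl
    sumSplits-*ˡ (x ∷ xs) a Φ = trans (+-cong (sumSplits-*ˡ xs a _) (sumSplits-*ˡ xs a _)) (sym (distribˡ a _ _))

    sumSplits-cancelProper : ∀ L {Φ Ψ : List X → List X → Carrier} →
                             (∀ K R → K ⊆ L → R ⊆ L → length K < length L → Φ K R ≈ Ψ K R) →
                             sumSplits L Φ ≈ sumSplits L Ψ → Φ L [] ≈ Ψ L []
    sumSplits-cancelProper []       agree eq = eq
    sumSplits-cancelProper (x ∷ xs) {Φ} {Ψ} agree eq =
      sumSplits-cancelProper xs (λ K R K⊆ R⊆ lt → agree (x ∷ K) R (≡.refl ∷ K⊆) (x ∷ʳ R⊆) (s≤s lt))
        (+-cancelʳ _ _ _ (trans eq (+-cong refl (sym rest))))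
      where
      rest : sumSplits xs (λ K R → Φ K (x ∷ R)) ≈ sumSplits xs (λ K R → Ψ K (x ∷ R))
      rest = sumSplits-cong xs (λ K R K⊆ R⊆ → agree K (x ∷ R) (x ∷ʳ K⊆) (≡.refl ∷ R⊆) (s≤s (length-mono-≤ K⊆)))

    -- Φ σ R summed over all sequences σ of distinct elements of L, R being the unused elements.
    sumArrangements : List X → (List X → List X → Carrier) → Carrier
    sumArrangements L Φ = sumSplits L (λ K R → sumOver (perms K) (λ σ → Φ σ R))

    sumArrangements-cong : ∀ L {Φ Ψ : List X → List X → Carrier} →
                           (∀ σ R → Φ σ R ≈ Ψ σ R) → sumArrangements L Φ ≈ sumArrangements L Ψ
    sumArrangements-cong L eq = sumSplits-cong L (λ K R _ _ → sumOver-cong (perms K) (λ {σ} _ → eq σ R))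

    sumArrangements-+ : ∀ L (Φ Ψ : List X → List X → Carrier) →
                        sumArrangements L (λ σ R → Φ σ R + Ψ σ R) ≈ sumArrangements L Φ + sumArrangements L Ψ
    sumArrangements-+ L Φ Ψ = trans (sumSplits-cong L (λ K R _ _ → sumOver-+ (perms K) _ _)) (sumSplits-+ L _ _)

    sumArrangements-*ˡ : ∀ L a (Φ : List X → List X → Carrier) →
                         sumArrangements L (λ σ R → a * Φ σ R) ≈ a * sumArrangements L Φ
    sumArrangements-*ˡ L a Φ = trans (sumSplits-cong L (λ K R _ _ → sumOver-*ˡ (perms K) a _)) (sumSplits-*ˡ L a _)

    sumArrangements-∷ : ∀ x xs (Φ : List X → List X → Carrier) →
                        sumArrangements (x ∷ xs) Φ ≈
                        sumArrangements xs (λ σ R → sumOver (insertions x σ) (λ τ → Φ τ R)) +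
                        sumArrangements xs (λ σ R → Φ σ (x ∷ R))
    sumArrangements-∷ x xs Φ = +-cong (sumSplits-cong xs (λ K R _ _ → sumOver-perms-∷ x K _)) refl

    sumArrangements-unfold : ∀ L (Φ : List X → List X → Carrier) →
                             sumArrangements L Φ ≈ Φ [] L + sumPicks L (λ y r → sumArrangements r (λ σ R → Φ (y ∷ σ) R))
    sumArrangements-unfold []       Φ = refl
    sumArrangements-unfold (x ∷ xs) Φ = begin
      sumArrangements (x ∷ xs) Φ
        ≈⟨ sumArrangements-∷ x xs Φ ⟩
      sumArrangements xs (λ σ R → sumOver (insertions x σ) (λ τ → Φ τ R)) + sumArrangements xs (λ σ R → Φ σ (x ∷ R))
        ≈⟨ +-cong (trans (sumArrangements-unfold xs _) (+-cong (+-identityʳ _) inserted)) (sumArrangements-unfold xs _) ⟩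
      (a + (P + W)) + (b + Q)
        ≈⟨ regroup ⟩
      b + ((a + P) + (W + Q))
        ≈⟨ +-cong refl (+-cong (sym (sumArrangements-unfold xs _)) (sym picked)) ⟩
      b + (sumArrangements xs (λ σ R → Φ (x ∷ σ) R) + sumPicks xs (λ y r → sumArrangements (x ∷ r) (λ σ R → Φ (y ∷ σ) R)))
        ∎
      where
      a = Φ [ x ] xs
      b = Φ [] (x ∷ xs)
      P = sumPicks xs (λ y r → sumArrangements r (λ σ R → Φ (x ∷ y ∷ σ) R))
      Q = sumPicks xs (λ y r → sumArrangements r (λ σ R → Φ (y ∷ σ) (x ∷ R)))
      W = sumPicks xs (λ y r → sumArrangements r (λ σ R → sumOver (insertions x σ) (λ τ → Φ (y ∷ τ) R)))
      inserted : sumPicks xs (λ y r → sumArrangements r (λ σ R → sumOver (insertions x (y ∷ σ)) (λ τ → Φ τ R))) ≈ P + W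
      inserted = trans (sumPicks-cong xs (λ y r _ → trans (sumArrangements-cong r (λ σ R → sumOver-insertions-∷ x y σ _))
                                                          (sumArrangements-+ r _ _)))
                       (sumPicks-+ xs _ _)
      picked : sumPicks xs (λ y r → sumArrangements (x ∷ r) (λ σ R → Φ (y ∷ σ) R)) ≈ W + Q
      picked = trans (sumPicks-cong xs (λ y r _ → sumArrangements-∷ x r _)) (sumPicks-+ xs _ _)
      regroup : (a + (P + W)) + (b + Q) ≈ b + ((a + P) + (W + Q))
      regroup = begin
        (a + (P + W)) + (b + Q)   ≈⟨ +-comm _ _ ⟩
        (b + Q) + (a + (P + W))   ≈⟨ +-assoc b Q _ ⟩
        b + (Q + (a + (P + W)))   ≈⟨ +-cong refl (+-comm Q _) ⟩
        b + ((a + (P + W)) + Q)   ≈⟨ +-cong refl (+-cong (+-assoc a P W) refl) ⟨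
        b + (((a + P) + W) + Q)   ≈⟨ +-cong refl (+-assoc _ W Q) ⟩
        b + ((a + P) + (W + Q))   ∎

    altSumPicks² : List X → (X → X → List X → Carrier) → Carrier
    altSumPicks² C H = altSumPicks C (λ y ys → altSumPicks ys (λ z zs → H y z zs))

    altSumPicks²-antisym : ∀ C (H : X → X → List X → Carrier) →
                           altSumPicks² C H ≈ - altSumPicks² C (λ y z zs → H z y zs)
    altSumPicks²-antisym []       H = sym -0#≈0#
    altSumPicks²-antisym (x ∷ xs) H = begin
      altSumPicks² (x ∷ xs) H                           ≈⟨ peel H ⟩
      P + - (Q + - R)                                   ≈⟨ +-cong refl (-‿cong (+-cong refl R≈)) ⟩
      P + - (Q + R′)                                    ≈⟨ regroup ⟩
      - (Q + - (P + - R′))                              ≈⟨ -‿cong (peel (λ y z zs → H z y zs)) ⟨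
      - altSumPicks² (x ∷ xs) (λ y z zs → H z y zs)     ∎
      where
      P = altSumPicks xs (λ z zs → H x z zs)
      Q = altSumPicks xs (λ y ys → H y x ys)
      R = altSumPicks² xs (λ y z zs → H y z (x ∷ zs))
      R′ = altSumPicks² xs (λ y z zs → H z y (x ∷ zs))
      peel : ∀ H′ → altSumPicks² (x ∷ xs) H′ ≈
                    altSumPicks xs (λ z zs → H′ x z zs) +
                    - (altSumPicks xs (λ y ys → H′ y x ys) + - altSumPicks² xs (λ y z zs → H′ y z (x ∷ zs)))
      peel H′ = +-cong refl (-‿cong (trans (altSumPicks-+ xs _ _) (+-cong refl (altSumPicks-neg xs _))))
      R≈ : - R ≈ R′
      R≈ = trans (-‿cong (altSumPicks²-antisym xs _)) (-‿involutive _)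
      regroup : P + - (Q + R′) ≈ - (Q + - (P + - R′))
      regroup = begin
        P + - (Q + R′)            ≈⟨ +-cong refl (-‿+-comm Q R′) ⟨
        P + (- Q + - R′)          ≈⟨ x+yz≈y+xz P _ _ ⟩
        - Q + (P + - R′)          ≈⟨ +-cong refl (-‿involutive _) ⟨
        - Q + - - (P + - R′)      ≈⟨ -‿+-comm Q _ ⟩
        - (Q + - (P + - R′))      ∎

  sumFin-cong : ∀ {k} {f g : Fin k → Carrier} → (∀ j → f j ≈ g j) → sumFin F f ≈ sumFin F g
  sumFin-cong {zero}  eq = refl
  sumFin-cong {suc k} eq = +-cong (eq zero) (sumFin-cong (λ j → eq (suc j)))

  sumFin-neg : ∀ {k} (f : Fin k → Carrier) → - sumFin F f ≈ sumFin F (λ j → - f j)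
  sumFin-neg {zero}  f = -0#≈0#
  sumFin-neg {suc k} f = trans (sym (-‿+-comm _ _)) (+-cong refl (sumFin-neg (λ j → f (suc j))))

  module Minors {n} (A : Matrix F n) where

    minor : List (Fin n) → List (Fin n) → Carrier
    minor []       cols = 1#
    minor (r ∷ rs) cols = altSumPicks cols (λ y ys → A r y * minor rs ys)

    minor-swap : ∀ a b rs cols → minor (a ∷ b ∷ rs) cols ≈ - minor (b ∷ a ∷ rs) cols
    minor-swap a b rs C = begin
      minor (a ∷ b ∷ rs) C                                          ≈⟨ twoRows a b ⟩
      altSumPicks² C (λ y z zs → A a y * (A b z * minor rs zs))     ≈⟨ altSumPicks²-antisym C _ ⟩
      - altSumPicks² C (λ y z zs → A a z * (A b y * minor rs zs))   ≈⟨ -‿cong (altSumPicks-cong C (λ y ys →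
                                                                         altSumPicks-cong ys (λ z zs → x*yz≈y*xz _ _ _))) ⟩
      - altSumPicks² C (λ y z zs → A b y * (A a z * minor rs zs))   ≈⟨ -‿cong (twoRows b a) ⟨
      - minor (b ∷ a ∷ rs) C                                        ∎
      where
      twoRows : ∀ a b → minor (a ∷ b ∷ rs) C ≈ altSumPicks² C (λ y z zs → A a y * (A b z * minor rs zs))
      twoRows a b = altSumPicks-cong C (λ y ys → sym (altSumPicks-* ys (A a y) _))

    minor-rowToFront : ∀ P x xs cols → minor (P ++ x ∷ xs) cols ≈ sign P * minor (x ∷ P ++ xs) cols
    minor-rowToFront []      x xs C = sym (*-identityˡ _)
    minor-rowToFront (p ∷ P) x xs C = begin
      altSumPicks C (λ y ys → A p y * minor (P ++ x ∷ xs) ys)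
        ≈⟨ altSumPicks-cong C (λ y ys → trans (*-cong refl (minor-rowToFront P x xs ys)) (x*yz≈y*xz _ _ _)) ⟩
      altSumPicks C (λ y ys → sign P * (A p y * minor (x ∷ P ++ xs) ys))   ≈⟨ altSumPicks-* C (sign P) _ ⟩
      sign P * minor (p ∷ x ∷ P ++ xs) C                                    ≈⟨ *-cong refl (minor-swap p x (P ++ xs) C) ⟩
      sign P * - minor (x ∷ p ∷ P ++ xs) C                                  ≈⟨ -‿distribʳ-* _ _ ⟨
      - (sign P * minor (x ∷ p ∷ P ++ xs) C)                                ≈⟨ -‿distribˡ-* _ _ ⟩
      - sign P * minor (x ∷ p ∷ P ++ xs) C                                  ∎

    altSumPicks-rowToFront : ∀ P L (cols : List (Fin n) → List (Fin n)) (g : Fin n → Carrier) →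
                             altSumPicks L (λ y ys → g y * minor (P ++ L) (cols ys)) ≈
                             sign P * sumPicks L (λ y ys → g y * minor (y ∷ P ++ ys) (cols ys))
    altSumPicks-rowToFront P []       cols g = sym (zeroʳ _)
    altSumPicks-rowToFront P (x ∷ xs) cols g = begin
      g x * minor (P ++ x ∷ xs) (cols xs) + - altSumPicks xs (λ y ys → g y * minor (P ++ x ∷ xs) (cols (x ∷ ys)))
        ≈⟨ +-cong (trans (*-cong refl (minor-rowToFront P x xs (cols xs))) (x*yz≈y*xz _ _ _))
                  (-‿cong (trans (reflexive (≡.cong (λ Z → altSumPicks xs (λ y ys → g y * minor Z (cols (x ∷ ys))))
                                                    (≡.sym (++-assoc P [ x ] xs))))
                                 (altSumPicks-rowToFront (P ++ [ x ]) xs (λ ys → cols (x ∷ ys)) g))) ⟩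
      sign P * front + - (sign (P ++ [ x ]) * sumPicks xs (λ y ys → g y * minor (y ∷ (P ++ [ x ]) ++ ys) (cols (x ∷ ys))))
        ≈⟨ +-cong refl (-‿cong (*-cong (sign-∷ʳ P x) (sumPicks-cong xs (λ y ys _ →
             reflexive (≡.cong (λ Z → g y * minor (y ∷ Z) (cols (x ∷ ys))) (++-assoc P [ x ] ys)))))) ⟩
      sign P * front + - (- sign P * rest)   ≈⟨ +-cong refl (trans (-‿cong (sym (-‿distribˡ-* _ _))) (-‿involutive _)) ⟩
      sign P * front + sign P * rest         ≈⟨ distribˡ _ _ _ ⟨
      sign P * (front + rest)                ∎
      where
      front = g x * minor (x ∷ P ++ xs) (cols xs)
      rest  = sumPicks xs (λ y ys → g y * minor (y ∷ P ++ x ∷ ys) (cols (x ∷ ys)))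

    pathTerm : Fin n → Fin n → List (Fin n) → List (Fin n) → Carrier
    pathTerm s u σ R = sign σ * (walkWeight F A s u σ * minor R R)

    minor-pathExpansion : ∀ L u s → minor (u ∷ L) (s ∷ L) ≈ sumArrangements L (pathTerm s u)
    minor-pathExpansion = lengthInduction _ step
      where
      extend : ∀ u y s σ R → - A u y * pathTerm s y σ R ≈ pathTerm s u (y ∷ σ) R
      extend u y s σ R = begin
        - a * (g * (w * d))     ≈⟨ -‿distribˡ-* _ _ ⟨
        - (a * (g * (w * d)))   ≈⟨ -‿cong (x*yz≈y*xz a g _) ⟩
        - (g * (a * (w * d)))   ≈⟨ -‿distribˡ-* _ _ ⟩
        - g * (a * (w * d))     ≈⟨ *-cong refl (*-assoc a w d) ⟨
        - g * ((a * w) * d)     ∎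
        where
        a = A u y
        g = sign σ
        w = walkWeight F A s y σ
        d = minor R R
      step : ∀ L → (∀ ys → length ys < length L → ∀ u s → minor (u ∷ ys) (s ∷ ys) ≈ sumArrangements ys (pathTerm s u)) →
             ∀ u s → minor (u ∷ L) (s ∷ L) ≈ sumArrangements L (pathTerm s u)
      step L ih u s = begin
        A u s * minor L L + - altSumPicks L (λ y ys → A u y * minor L (s ∷ ys))
          ≈⟨ +-cong (sym (*-identityˡ _)) (-‿cong (trans (altSumPicks-rowToFront [] L (s ∷_) (A u)) (*-identityˡ _))) ⟩
        pathTerm s u [] L + - sumPicks L (λ y ys → A u y * minor (y ∷ ys) (s ∷ ys))
          ≈⟨ +-cong refl (-‿cong (sumPicks-cong L (λ y ys len → *-cong refl (ih ys (≤-reflexive len) y s)))) ⟩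
        pathTerm s u [] L + - sumPicks L (λ y ys → A u y * sumArrangements ys (pathTerm s y))
          ≈⟨ +-cong refl (sumPicks-neg L _) ⟨
        pathTerm s u [] L + sumPicks L (λ y ys → - (A u y * sumArrangements ys (pathTerm s y)))
          ≈⟨ +-cong refl (sumPicks-cong L (λ y ys _ → begin
               - (A u y * sumArrangements ys (pathTerm s y))              ≈⟨ -‿distribˡ-* _ _ ⟩
               - A u y * sumArrangements ys (pathTerm s y)                ≈⟨ sumArrangements-*ˡ ys _ _ ⟨
               sumArrangements ys (λ σ R → - A u y * pathTerm s y σ R)    ≈⟨ sumArrangements-cong ys (extend u y s) ⟩
               sumArrangements ys (λ σ R → pathTerm s u (y ∷ σ) R)        ∎)) ⟩
        pathTerm s u [] L + sumPicks L (λ y ys → sumArrangements ys (λ σ R → pathTerm s u (y ∷ σ) R))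
          ≈⟨ sumArrangements-unfold L _ ⟨
        sumArrangements L (pathTerm s u)
          ∎

    cycleSumOn : List (Fin n) → Carrier
    cycleSumOn []      = 0#
    cycleSumOn (s ∷ K) = sumOver (perms K) (cycleWeight F A s)

    principalMinor-cycleExpansion : ∀ s L → minor (s ∷ L) (s ∷ L) ≈
                                            sumSplits L (λ K R → sign K * (cycleSumOn (s ∷ K) * minor R R))
    principalMinor-cycleExpansion s L = trans (minor-pathExpansion L s s) (sumSplits-cong L (λ K R _ _ → begin
      sumOver (perms K) (λ σ → sign σ * (cycleWeight F A s σ * minor R R))
        ≈⟨ sumOver-cong (perms K) (λ σ∈ → *-cong (reflexive (≡.cong signℕ (∈-perms-length K σ∈))) refl) ⟩
      sumOver (perms K) (λ σ → sign K * (cycleWeight F A s σ * minor R R))   ≈⟨ sumOver-*ˡ (perms K) _ _ ⟩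
      sign K * sumOver (perms K) (λ σ → cycleWeight F A s σ * minor R R)     ≈⟨ *-cong refl (sumOver-*ʳ (perms K) _ _) ⟩
      sign K * (cycleSumOn (s ∷ K) * minor R R)                              ∎))

    hamiltonianCycleSum≡cycleSumOn : ∀ S → hamiltonianCycleSum F A S ≡ cycleSumOn (members F S)
    hamiltonianCycleSum≡cycleSumOn S with members F S
    ... | []    = ≡.refl
    ... | s ∷ K = ≡.refl

    altSumPicks-tabulate : ∀ {k} (c : Fin (suc k) → Fin n) G →
                           altSumPicks (tabulate c) G ≈ sumFin F (λ j → sgn F j * G (c j) (tabulate (λ b → c (punchIn j b))))
    altSumPicks-tabulate {zero}  c G = +-cong (sym (*-identityˡ _)) -0#≈0#
    altSumPicks-tabulate {suc k} c G =
      +-cong (sym (*-identityˡ _))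
        (trans (-‿cong (altSumPicks-tabulate (λ b → c (suc b)) G′))
          (trans (sumFin-neg f) (sumFin-cong {suc k} (λ j → -‿distribˡ-* (sgn F j) (G′ (c (suc j)) (tabulate (λ b → c (suc (punchIn j b)))))))))
      where
      G′ : Fin n → List (Fin n) → Carrier
      G′ y r = G y (c zero ∷ r)
      f : Fin (suc k) → Carrier
      f j = sgn F j * G′ (c (suc j)) (tabulate (λ b → c (suc (punchIn j b))))

    det≈minor : ∀ {k} (r c : Fin k → Fin n) → det F (λ i j → A (r i) (c j)) ≈ minor (tabulate r) (tabulate c)
    det≈minor {zero}  r c = refl
    det≈minor {suc k} r c = trans
      (sumFin-cong {suc k} (λ j → trans (*-assoc (sgn F j) (A (r zero) (c j)) _)
        (*-cong refl (*-cong refl (det≈minor (λ a → r (suc a)) (λ b → c (punchIn j b)))))))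
      (sym (altSumPicks-tabulate c (λ y ys → A (r zero) y * minor (tabulate (λ a → r (suc a))) ys)))

    det-principalSubmatrix : ∀ S → det F (principalSubmatrix F A S) ≈ minor (members F S) (members F S)
    det-principalSubmatrix S = trans (det≈minor (lookup M) (lookup M))
                                     (reflexive (≡.cong₂ minor (tabulate-lookup M) (tabulate-lookup M)))
      where M = members F S

  ⊆-map-preimage : ∀ {Y Z : Set} (f : Y → Z) {K} M → K ⊆ map f M → ∃ λ K′ → K ≡ map f K′ × K′ ⊆ M
  ⊆-map-preimage f []      []            = [] , ≡.refl , []
  ⊆-map-preimage f (m ∷ M) (_ ∷ʳ K⊆)     with ⊆-map-preimage f M K⊆
  ... | K′ , ≡.refl , K′⊆ = K′ , ≡.refl , m ∷ʳ K′⊆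
  ⊆-map-preimage f (m ∷ M) (≡.refl ∷ K⊆) with ⊆-map-preimage f M K⊆
  ... | K′ , ≡.refl , K′⊆ = m ∷ K′ , ≡.refl , ≡.refl ∷ K′⊆

  mutual
    ⊆-members⇒members : ∀ {k} (S : Subset k) {X} → X ⊆ members F S → ∃ λ T → members F T ≡ X
    ⊆-members⇒members []          []            = [] , ≡.refl
    ⊆-members⇒members (true ∷ S)  (_ ∷ʳ X⊆)     = let T , eq = ⊆-map-suc-members⇒members S X⊆ in false ∷ T , eq
    ⊆-members⇒members (true ∷ S)  (≡.refl ∷ X⊆) = let T , eq = ⊆-map-suc-members⇒members S X⊆ in true ∷ T , ≡.cong (zero ∷_) eq
    ⊆-members⇒members (false ∷ S) X⊆            = let T , eq = ⊆-map-suc-members⇒members S X⊆ in false ∷ T , eq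

    ⊆-map-suc-members⇒members : ∀ {k} (S : Subset k) {X} → X ⊆ map suc (members F S) → ∃ λ T → map suc (members F T) ≡ X
    ⊆-map-suc-members⇒members S X⊆ with ⊆-map-preimage suc (members F S) X⊆
    ... | X′ , ≡.refl , X′⊆ = let T , eq = ⊆-members⇒members S X′⊆ in T , ≡.cong (map suc) eq

  ∈-members⁻ : ∀ {k} (S : Subset k) {x} → x ∈ members F S → x ∈ₛ S
  ∈-members⁻ (true ∷ S)  (here ≡.refl) = here
  ∈-members⁻ (true ∷ S)  (there x∈)    with ∈-map⁻ suc x∈
  ... | y , y∈ , ≡.refl = there (∈-members⁻ S y∈)
  ∈-members⁻ (false ∷ S) x∈            with ∈-map⁻ suc x∈
  ... | y , y∈ , ≡.refl = there (∈-members⁻ S y∈)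

  module _ {n} (A B : Matrix F n) where
    private
      module MA = Minors A
      module MB = Minors B

    cycleSums⇒principalMinors : ∀ U → (∀ {s K} → s ∷ K ⊆ U → MA.cycleSumOn (s ∷ K) ≈ MB.cycleSumOn (s ∷ K)) →
                                ∀ {X} → X ⊆ U → MA.minor X X ≈ MB.minor X X
    cycleSums⇒principalMinors []      cycles []            = refl
    cycleSums⇒principalMinors (u ∷ U) cycles (_ ∷ʳ X⊆)     = cycleSums⇒principalMinors U (λ sK⊆ → cycles (u ∷ʳ sK⊆)) X⊆
    cycleSums⇒principalMinors (u ∷ U) cycles {u ∷ L} (≡.refl ∷ L⊆) = begin
      MA.minor (u ∷ L) (u ∷ L)
        ≈⟨ MA.principalMinor-cycleExpansion u L ⟩
      sumSplits L (λ K R → sign K * (MA.cycleSumOn (u ∷ K) * MA.minor R R))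
        ≈⟨ sumSplits-cong L (λ K R K⊆ R⊆ → *-cong refl (*-cong (cycles (≡.refl ∷ ⊆-trans K⊆ L⊆))
             (cycleSums⇒principalMinors U (λ sK⊆ → cycles (u ∷ʳ sK⊆)) (⊆-trans R⊆ L⊆)))) ⟩
      sumSplits L (λ K R → sign K * (MB.cycleSumOn (u ∷ K) * MB.minor R R))
        ≈⟨ MB.principalMinor-cycleExpansion u L ⟨
      MB.minor (u ∷ L) (u ∷ L)
        ∎

    principalMinors⇒cycleSums : ∀ U → (∀ {X} → X ⊆ U → MA.minor X X ≈ MB.minor X X) →
                                ∀ X → X ⊆ U → MA.cycleSumOn X ≈ MB.cycleSumOn X
    principalMinors⇒cycleSums U minors = lengthInduction _ step
      where
      step : ∀ X → (∀ Y → length Y < length X → Y ⊆ U → MA.cycleSumOn Y ≈ MB.cycleSumOn Y) →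
             X ⊆ U → MA.cycleSumOn X ≈ MB.cycleSumOn X
      step []      ih _   = refl
      step (s ∷ L) ih sL⊆ = begin
        MA.cycleSumOn (s ∷ L)        ≈⟨ *-identityʳ _ ⟨
        MA.cycleSumOn (s ∷ L) * 1#   ≈⟨ sign-cancel (length L) whole ⟩
        MB.cycleSumOn (s ∷ L) * 1#   ≈⟨ *-identityʳ _ ⟩
        MB.cycleSumOn (s ∷ L)        ∎
        where
        whole = sumSplits-cancelProper L
          (λ K R K⊆ R⊆ lt → *-cong refl (*-cong (ih (s ∷ K) (s≤s lt) (⊆-trans (≡.refl ∷ K⊆) sL⊆))
                                                 (minors (⊆-trans R⊆ (∷ˡ⁻ sL⊆)))))
          (trans (sym (MA.principalMinor-cycleExpansion s L))
                 (trans (minors sL⊆) (MB.principalMinor-cycleExpansion s L)))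

    principalMinorEquivalent⇒cycleSums : PrincipalMinorEquivalent F A B →
                                         ∀ S → Nonempty S → hamiltonianCycleSum F A S ≈ hamiltonianCycleSum F B S
    principalMinorEquivalent⇒cycleSums pme S _ =
      ≡.subst₂ _≈_ (≡.sym (MA.hamiltonianCycleSum≡cycleSumOn S)) (≡.sym (MB.hamiltonianCycleSum≡cycleSumOn S))
        (principalMinors⇒cycleSums (members F S) minors (members F S) ⊆-refl)
      where
      minors : ∀ {X} → X ⊆ members F S → MA.minor X X ≈ MB.minor X X
      minors X⊆ with ⊆-members⇒members S X⊆
      ... | T , ≡.refl = trans (sym (MA.det-principalSubmatrix T)) (trans (pme T) (MB.det-principalSubmatrix T))

    cycleSums⇒principalMinorEquivalent : (∀ S → Nonempty S → hamiltonianCycleSum F A S ≈ hamiltonianCycleSum F B S) →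
                                         PrincipalMinorEquivalent F A B
    cycleSums⇒principalMinorEquivalent cycles S =
      trans (MA.det-principalSubmatrix S)
        (trans (cycleSums⇒principalMinors (members F S) cycles′ ⊆-refl) (sym (MB.det-principalSubmatrix S)))
      where
      cycles′ : ∀ {s K} → s ∷ K ⊆ members F S → MA.cycleSumOn (s ∷ K) ≈ MB.cycleSumOn (s ∷ K)
      cycles′ {s} sK⊆ with ⊆-members⇒members S sK⊆
      ... | T , eq = ≡.subst (λ Z → MA.cycleSumOn Z ≈ MB.cycleSumOn Z) eq
                       (≡.subst₂ _≈_ (MA.hamiltonianCycleSum≡cycleSumOn T) (MB.hamiltonianCycleSum≡cycleSumOn T)
                         (cycles T (s , ∈-members⁻ T (≡.subst (s ∈_) (≡.sym eq) (here ≡.refl)))))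

lemma18 : ∀ {c ℓ} (F : Field c ℓ) (n : ℕ) (A B : Matrix F n) →
    PrincipalMinorEquivalent F A B ⇔
    (∀ (S : Subset n) → Nonempty S →
    Field._≈_ F (hamiltonianCycleSum F A S) (hamiltonianCycleSum F B S))
lemma18 F n A B = mk⇔ (principalMinorEquivalent⇒cycleSums A B) (cycleSums⇒principalMinorEquivalent A B)
  where open CycleExpansion F
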